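{- Let $p$ be a prime, $h(x)\in\mathbb Z[x]$, and let $d=\deg_p h\ge1$ be the degree of the reduction of $h$ modulo $p$. Then for every $m\ge1$, \[\#\{a\bmod p^m:\ h(a)\equiv0\pmod{p^m}\}\le d\cdot p^{\,m-\lceil m/d\rceil}.\] -}

module Defs where

open import Data.Nat as ℕ using (ℕ; zero; suc; _∸_; _^_; _/_; _≤_)
open import Data.Nat.Divisibility using (_∣?_)
open import Data.Integer as ℤ using (ℤ; +_; ∣_∣)
open import Data.Integer.Divisibility as ℤD using ()
open import Data.List using (List; []; _∷_; length; filter)
open import Data.Fin using (Fin; toℕ)
open import Data.Fin.Base using ()
open import Data.List using (allFin)
open import Relation.Nullary using (¬_)

-- A polynomial in ℤ[x] is its list of coefficients, constant term first:
-- c₀ ∷ c₁ ∷ … represents c₀ + c₁ x + c₂ x² + …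
Poly : Set
Poly = List ℤ

eval : Poly → ℤ → ℤ
eval []       a = + 0
eval (c ∷ cs) a = c ℤ.+ a ℤ.* eval cs a

coeff : Poly → ℕ → ℤ
coeff []       _       = + 0
coeff (c ∷ cs) zero    = c
coeff (c ∷ cs) (suc i) = coeff cs i

DegModP : ℕ → Poly → ℕ → Set
DegModP p h d = (¬ (ℤ.+ p ℤD.∣ coeff h d)) × (∀ i → d ℕ.< i → ℤ.+ p ℤD.∣ coeff h i)
  where open import Data.Product using (_×_)

ceilDiv : (m d : ℕ) → .{{ℕ.NonZero d}} → ℕ
ceilDiv m d = (m ℕ.+ (d ∸ 1)) / d

rootCount : (n : ℕ) → Poly → ℕ
rootCount n h = length (filter (λ (a : Fin n) → n ∣? ∣ eval h (+ toℕ a) ∣) (allFin n))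

-- Induct on the exponent k of the modulus, bounding #{a mod pᵏ : pⁿ ∣ f(a)} by d p^(k - ⌈n/d⌉)
-- for all n ≤ k. Write a = r + p y with r < p. For each residue r, f(r + p y) = pᶜ Q(y) where
-- some coefficient of Q is prime to p; comparing coefficients shows e := deg_p Q ≤ c and that r is
-- a root of f of order ≥ c modulo p. Dividing out roots one at a time, these orders add up to at
-- most d. If n ≤ c the fibre over r has at most pᵏ⁻¹ points; otherwise it has as many points as
-- {y mod pᵏ⁻¹ : p^(n-c) ∣ Q(y)}, at most e p^(k - 1 - ⌈(n - c)/e⌉) by induction; since e, c ≤ d we have
-- ⌈n/d⌉ ≤ 1 + ⌈(n - c)/e⌉, so either way the fibre contributes at most c p^(k - ⌈n/d⌉).

module Submission where

open import Defs
open import Data.Nat as ℕ using (ℕ; zero; suc; _^_)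
import Data.Nat.Properties as ℕP
open import Data.Integer as ℤ using (ℤ; +_; ∣_∣)
import Data.Integer.Properties as ℤP
open import Data.List using ([]; _∷_; length; filter; tabulate)
open import Data.Fin as Fin using (Fin; toℕ)
open import Data.Nat.Divisibility as ℕD using (_∣_; _∣?_; divides)
open import Data.Integer.Divisibility.Signed
  using (∣ᵤ⇒∣; ∣⇒∣ᵤ; ∣m∣n⇒∣m+n; ∣n⇒∣m*n; ∣m+n∣n⇒∣m)
  renaming (_∣_ to _∣ᵢ_; _∣?_ to _∣ᵢ?_; divides to dividesᵢ)
open import Data.Product using (Σ; _,_; _×_; proj₁; proj₂)
open import Data.Sum using (_⊎_; inj₁; inj₂)
open import Data.Nat.Primality using (Prime; prime⇒nonZero; euclidsLemma)
open import Data.Empty using (⊥-elim)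
open import Function using (id; _∘_)
open import Relation.Nullary using (¬_; Dec; yes; no)
open import Relation.Binary.Definitions using (tri<; tri≈; tri>)
import Relation.Unary as U
open import Relation.Binary.PropositionalEquality

module Polynomials where

  open import Data.Integer using (_+_; _*_; _-_)
  open import Data.Integer.Tactic.RingSolver using (solve-∀)
  open ≡-Reasoning

  infixl 6 _+ₚ_
  infixr 7 _·ₚ_

  _+ₚ_ : Poly → Poly → Poly
  []       +ₚ q        = q
  (a ∷ as) +ₚ []       = a ∷ as
  (a ∷ as) +ₚ (b ∷ bs) = a + b ∷ as +ₚ bs

  _·ₚ_ : ℤ → Poly → Poly
  a ·ₚ []       = []
  a ·ₚ (c ∷ cs) = a * c ∷ a ·ₚ cs

  coeff-+ₚ : ∀ P Q k → coeff (P +ₚ Q) k ≡ coeff P k + coeff Q k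
  coeff-+ₚ []       Q        k       = sym (ℤP.+-identityˡ _)
  coeff-+ₚ (a ∷ as) []       k       = sym (ℤP.+-identityʳ _)
  coeff-+ₚ (a ∷ as) (b ∷ bs) zero    = refl
  coeff-+ₚ (a ∷ as) (b ∷ bs) (suc k) = coeff-+ₚ as bs k

  eval-+ₚ : ∀ P Q x → eval (P +ₚ Q) x ≡ eval P x + eval Q x
  eval-+ₚ []       Q        x = sym (ℤP.+-identityˡ _)
  eval-+ₚ (a ∷ as) []       x = sym (ℤP.+-identityʳ _)
  eval-+ₚ (a ∷ as) (b ∷ bs) x = begin
    a + b + x * eval (as +ₚ bs) x           ≡⟨ cong (λ t → a + b + x * t) (eval-+ₚ as bs x) ⟩
    a + b + x * (eval as x + eval bs x)     ≡⟨ ring a b x (eval as x) (eval bs x) ⟩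
    a + x * eval as x + (b + x * eval bs x) ∎
    where
    ring : ∀ a b x u v → a + b + x * (u + v) ≡ a + x * u + (b + x * v)
    ring = solve-∀

  coeff-·ₚ : ∀ a P k → coeff (a ·ₚ P) k ≡ a * coeff P k
  coeff-·ₚ a []       k       = sym (ℤP.*-zeroʳ a)
  coeff-·ₚ a (c ∷ cs) zero    = refl
  coeff-·ₚ a (c ∷ cs) (suc k) = coeff-·ₚ a cs k

  eval-·ₚ : ∀ a P x → eval (a ·ₚ P) x ≡ a * eval P x
  eval-·ₚ a []       x = sym (ℤP.*-zeroʳ a)
  eval-·ₚ a (c ∷ cs) x = begin
    a * c + x * eval (a ·ₚ cs) x ≡⟨ cong (λ t → a * c + x * t) (eval-·ₚ a cs x) ⟩
    a * c + x * (a * eval cs x)  ≡⟨ ring a c x (eval cs x) ⟩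
    a * (c + x * eval cs x)      ∎
    where
    ring : ∀ a c x u → a * c + x * (a * u) ≡ a * (c + x * u)
    ring = solve-∀

  ·ₚ-identityˡ : ∀ P → + 1 ·ₚ P ≡ P
  ·ₚ-identityˡ []       = refl
  ·ₚ-identityˡ (c ∷ cs) = cong₂ _∷_ (ℤP.*-identityˡ c) (·ₚ-identityˡ cs)

  ·ₚ-assoc : ∀ a b P → a ·ₚ (b ·ₚ P) ≡ (a * b) ·ₚ P
  ·ₚ-assoc a b []       = refl
  ·ₚ-assoc a b (c ∷ cs) = cong₂ _∷_ (sym (ℤP.*-assoc a b c)) (·ₚ-assoc a b cs)

  taylor : Poly → ℤ → Poly
  taylor []       r = []
  taylor (c ∷ cs) r = (c ∷ []) +ₚ (r ·ₚ taylor cs r +ₚ (+ 0 ∷ taylor cs r))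

  taylorCoeff : Poly → ℤ → ℕ → ℤ
  taylorCoeff h r = coeff (taylor h r)

  eval-taylor : ∀ h r x → eval (taylor h r) x ≡ eval h (r + x)
  eval-taylor []       r x = refl
  eval-taylor (c ∷ cs) r x = begin
    eval ((c ∷ []) +ₚ (r ·ₚ S +ₚ (+ 0 ∷ S))) x
      ≡⟨ eval-+ₚ (c ∷ []) (r ·ₚ S +ₚ (+ 0 ∷ S)) x ⟩
    c + x * + 0 + eval (r ·ₚ S +ₚ (+ 0 ∷ S)) x
      ≡⟨ cong (λ t → c + x * + 0 + t) (eval-+ₚ (r ·ₚ S) (+ 0 ∷ S) x) ⟩
    c + x * + 0 + (eval (r ·ₚ S) x + (+ 0 + x * eval S x))
      ≡⟨ cong (λ t → c + x * + 0 + (t + (+ 0 + x * eval S x))) (eval-·ₚ r S x) ⟩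
    c + x * + 0 + (r * eval S x + (+ 0 + x * eval S x))
      ≡⟨ cong (λ t → c + x * + 0 + (r * t + (+ 0 + x * t))) (eval-taylor cs r x) ⟩
    c + x * + 0 + (r * E + (+ 0 + x * E))
      ≡⟨ ring c x r E ⟩
    c + (r + x) * E ∎
    where
    S = taylor cs r
    E = eval cs (r + x)
    ring : ∀ c x r E → c + x * + 0 + (r * E + (+ 0 + x * E)) ≡ c + (r + x) * E
    ring = solve-∀

  taylorCoeff-∷-zero : ∀ c cs r → taylorCoeff (c ∷ cs) r 0 ≡ c + r * taylorCoeff cs r 0
  taylorCoeff-∷-zero c cs r = begin
    coeff ((c ∷ []) +ₚ (r ·ₚ S +ₚ (+ 0 ∷ S))) 0 ≡⟨ coeff-+ₚ (c ∷ []) (r ·ₚ S +ₚ (+ 0 ∷ S)) 0 ⟩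
    c + coeff (r ·ₚ S +ₚ (+ 0 ∷ S)) 0           ≡⟨ cong (λ t → c + t) (coeff-+ₚ (r ·ₚ S) (+ 0 ∷ S) 0) ⟩
    c + (coeff (r ·ₚ S) 0 + + 0)                ≡⟨ cong (λ t → c + t) (ℤP.+-identityʳ _) ⟩
    c + coeff (r ·ₚ S) 0                        ≡⟨ cong (λ t → c + t) (coeff-·ₚ r S 0) ⟩
    c + r * coeff S 0                           ∎
    where S = taylor cs r

  taylorCoeff-∷-suc : ∀ c cs r k →
    taylorCoeff (c ∷ cs) r (suc k) ≡ r * taylorCoeff cs r (suc k) + taylorCoeff cs r k
  taylorCoeff-∷-suc c cs r k = begin
    coeff ((c ∷ []) +ₚ (r ·ₚ S +ₚ (+ 0 ∷ S))) (suc k) ≡⟨ coeff-+ₚ (c ∷ []) (r ·ₚ S +ₚ (+ 0 ∷ S)) (suc k) ⟩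
    + 0 + coeff (r ·ₚ S +ₚ (+ 0 ∷ S)) (suc k)         ≡⟨ ℤP.+-identityˡ _ ⟩
    coeff (r ·ₚ S +ₚ (+ 0 ∷ S)) (suc k)               ≡⟨ coeff-+ₚ (r ·ₚ S) (+ 0 ∷ S) (suc k) ⟩
    coeff (r ·ₚ S) (suc k) + coeff S k                ≡⟨ cong (_+ coeff S k) (coeff-·ₚ r S (suc k)) ⟩
    r * coeff S (suc k) + coeff S k                   ∎
    where S = taylor cs r

  taylorCoeff-zero : ∀ h r → taylorCoeff h r 0 ≡ eval h r
  taylorCoeff-zero []       r = refl
  taylorCoeff-zero (c ∷ cs) r = begin
    taylorCoeff (c ∷ cs) r 0    ≡⟨ taylorCoeff-∷-zero c cs r ⟩
    c + r * taylorCoeff cs r 0  ≡⟨ cong (λ t → c + r * t) (taylorCoeff-zero cs r) ⟩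
    c + r * eval cs r           ∎

  dilate : ℤ → Poly → Poly
  dilate a []       = []
  dilate a (c ∷ cs) = c ∷ a ·ₚ dilate a cs

  eval-dilate : ∀ a P x → eval (dilate a P) x ≡ eval P (a * x)
  eval-dilate a []       x = refl
  eval-dilate a (c ∷ cs) x = begin
    c + x * eval (a ·ₚ dilate a cs) x ≡⟨ cong (λ t → c + x * t) (eval-·ₚ a (dilate a cs) x) ⟩
    c + x * (a * eval (dilate a cs) x) ≡⟨ cong (λ t → c + x * (a * t)) (eval-dilate a cs x) ⟩
    c + x * (a * eval cs (a * x))     ≡⟨ ring c x a (eval cs (a * x)) ⟩
    c + a * x * eval cs (a * x)       ∎
    where
    ring : ∀ c x a u → c + x * (a * u) ≡ c + a * x * u
    ring = solve-∀

  coeff-dilate : ∀ m P k → coeff (dilate (+ m) P) k ≡ + (m ^ k) * coeff P k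
  coeff-dilate m []       k       = sym (ℤP.*-zeroʳ (+ (m ^ k)))
  coeff-dilate m (c ∷ cs) zero    = sym (ℤP.*-identityˡ c)
  coeff-dilate m (c ∷ cs) (suc k) = begin
    coeff (+ m ·ₚ dilate (+ m) cs) k  ≡⟨ coeff-·ₚ (+ m) (dilate (+ m) cs) k ⟩
    + m * coeff (dilate (+ m) cs) k   ≡⟨ cong (+ m *_) (coeff-dilate m cs k) ⟩
    + m * (+ (m ^ k) * coeff cs k)    ≡⟨ ℤP.*-assoc (+ m) (+ (m ^ k)) (coeff cs k) ⟨
    + m * + (m ^ k) * coeff cs k      ≡⟨ cong (_* coeff cs k) (ℤP.pos-* m (m ^ k)) ⟨
    + (m ℕ.* m ^ k) * coeff cs k      ∎

  -- Synthetic division: h = (x - r) · syntheticDiv h r + h r.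
  syntheticDiv : Poly → ℤ → Poly
  syntheticDiv []       r = []
  syntheticDiv (c ∷ cs) r = eval cs r ∷ syntheticDiv cs r

  -- Coefficientwise, the identity  h (s + x) = (x + (s - r)) · q (s + x) + h r  for  q = syntheticDiv h r.
  taylorCoeff-syntheticDiv-zero : ∀ h r s →
    taylorCoeff h s 0 ≡ (s - r) * taylorCoeff (syntheticDiv h r) s 0 + eval h r
  taylorCoeff-syntheticDiv-suc : ∀ h r s k →
    taylorCoeff h s (suc k) ≡ (s - r) * taylorCoeff (syntheticDiv h r) s (suc k) + taylorCoeff (syntheticDiv h r) s k

  taylorCoeff-syntheticDiv-zero []       r s = sym (trans (ℤP.+-identityʳ _) (ℤP.*-zeroʳ (s - r)))
  taylorCoeff-syntheticDiv-zero (c ∷ cs) r s = begin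
    taylorCoeff (c ∷ cs) s 0                ≡⟨ taylorCoeff-∷-zero c cs s ⟩
    c + s * taylorCoeff cs s 0              ≡⟨ cong (λ t → c + s * t) (taylorCoeff-syntheticDiv-zero cs r s) ⟩
    c + s * ((s - r) * A + e)               ≡⟨ ring c s r A e ⟩
    (s - r) * (e + s * A) + (c + r * e)     ≡⟨ cong (λ t → (s - r) * t + (c + r * e)) (taylorCoeff-∷-zero e q s) ⟨
    (s - r) * taylorCoeff (e ∷ q) s 0 + (c + r * e) ∎
    where
    q = syntheticDiv cs r
    e = eval cs r
    A = taylorCoeff q s 0
    ring : ∀ c s r A e → c + s * ((s - r) * A + e) ≡ (s - r) * (e + s * A) + (c + r * e)
    ring = solve-∀

  taylorCoeff-syntheticDiv-suc []       r s k = sym (trans (ℤP.+-identityʳ _) (ℤP.*-zeroʳ (s - r)))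
  taylorCoeff-syntheticDiv-suc (c ∷ cs) r s zero = begin
    taylorCoeff (c ∷ cs) s 1                        ≡⟨ taylorCoeff-∷-suc c cs s 0 ⟩
    s * taylorCoeff cs s 1 + taylorCoeff cs s 0     ≡⟨ cong₂ (λ a b → s * a + b) (taylorCoeff-syntheticDiv-suc cs r s 0)
                                                                                 (taylorCoeff-syntheticDiv-zero cs r s) ⟩
    s * ((s - r) * A + B) + ((s - r) * B + e)       ≡⟨ ring s r A B e ⟩
    (s - r) * (s * A + B) + (e + s * B)             ≡⟨ cong₂ (λ a b → (s - r) * a + b) (taylorCoeff-∷-suc e q s 0)
                                                                                       (taylorCoeff-∷-zero e q s) ⟨
    (s - r) * taylorCoeff (e ∷ q) s 1 + taylorCoeff (e ∷ q) s 0 ∎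
    where
    q = syntheticDiv cs r
    e = eval cs r
    A = taylorCoeff q s 1
    B = taylorCoeff q s 0
    ring : ∀ s r A B e → s * ((s - r) * A + B) + ((s - r) * B + e) ≡ (s - r) * (s * A + B) + (e + s * B)
    ring = solve-∀
  taylorCoeff-syntheticDiv-suc (c ∷ cs) r s (suc k) = begin
    taylorCoeff (c ∷ cs) s (suc (suc k))                    ≡⟨ taylorCoeff-∷-suc c cs s (suc k) ⟩
    s * taylorCoeff cs s (suc (suc k)) + taylorCoeff cs s (suc k)
      ≡⟨ cong₂ (λ a b → s * a + b) (taylorCoeff-syntheticDiv-suc cs r s (suc k)) (taylorCoeff-syntheticDiv-suc cs r s k) ⟩
    s * ((s - r) * A + B) + ((s - r) * B + C)               ≡⟨ ring s r A B C ⟩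
    (s - r) * (s * A + B) + (s * B + C)
      ≡⟨ cong₂ (λ a b → (s - r) * a + b) (taylorCoeff-∷-suc e q s (suc k)) (taylorCoeff-∷-suc e q s k) ⟨
    (s - r) * taylorCoeff (e ∷ q) s (suc (suc k)) + taylorCoeff (e ∷ q) s (suc k) ∎
    where
    q = syntheticDiv cs r
    e = eval cs r
    A = taylorCoeff q s (suc (suc k))
    B = taylorCoeff q s (suc k)
    C = taylorCoeff q s k
    ring : ∀ s r A B C → s * ((s - r) * A + B) + ((s - r) * B + C) ≡ (s - r) * (s * A + B) + (s * B + C)
    ring = solve-∀

open Polynomials
open import Data.Nat using (_+_; _*_; _∸_; _≤_; _<_; z≤n; s≤s; NonZero)
open import Data.Nat.Properties
  using (≤-refl; ≤-trans; ≤-reflexive; +-mono-≤; +-monoˡ-≤; +-monoʳ-≤; +-comm; +-assoc; +-suc; *-comm; *-distribʳ-+)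
open import Data.Nat.DivMod using (_/_; _%_; m≡m%n+[m/n]*n; m%n<n; m<n*o⇒m/o<n)

∑< : ℕ → (ℕ → ℕ) → ℕ
∑< zero    f = 0
∑< (suc n) f = ∑< n f + f n

syntax ∑< n (λ i → e) = ∑[ i < n ] e

∑-cong : ∀ n {f g : ℕ → ℕ} → (∀ i → f i ≡ g i) → ∑< n f ≡ ∑< n g
∑-cong zero    f≗g = refl
∑-cong (suc n) f≗g = cong₂ _+_ (∑-cong n f≗g) (f≗g n)

∑-mono-≤ : ∀ n {f g : ℕ → ℕ} → (∀ i → f i ≤ g i) → ∑< n f ≤ ∑< n g
∑-mono-≤ zero    f≤g = z≤n
∑-mono-≤ (suc n) f≤g = +-mono-≤ (∑-mono-≤ n f≤g) (f≤g n)

∑-≤-length : ∀ n {f : ℕ → ℕ} → (∀ i → f i ≤ 1) → ∑< n f ≤ n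
∑-≤-length zero    f≤1 = z≤n
∑-≤-length (suc n) f≤1 = ≤-trans (+-mono-≤ (∑-≤-length n f≤1) (f≤1 n)) (≤-reflexive (+-comm n 1))

∑-zero : ∀ n {f : ℕ → ℕ} → (∀ i → f i ≡ 0) → ∑< n f ≡ 0
∑-zero zero    f≗0 = refl
∑-zero (suc n) f≗0 = cong₂ _+_ (∑-zero n f≗0) (f≗0 n)

∑-distribʳ-* : ∀ n (f : ℕ → ℕ) c → ∑[ i < n ] (f i * c) ≡ ∑< n f * c
∑-distribʳ-* zero    f c = refl
∑-distribʳ-* (suc n) f c = trans (cong (_+ f n * c) (∑-distribʳ-* n f c)) (sym (*-distribʳ-+ c (∑< n f) (f n)))

∑-distrib-+ : ∀ n (f g : ℕ → ℕ) → ∑[ i < n ] (f i + g i) ≡ ∑< n f + ∑< n g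
∑-distrib-+ zero    f g = refl
∑-distrib-+ (suc n) f g = begin
  ∑[ i < n ] (f i + g i) + (f n + g n)  ≡⟨ cong (_+ (f n + g n)) (∑-distrib-+ n f g) ⟩
  ∑< n f + ∑< n g + (f n + g n)         ≡⟨ ring (∑< n f) (∑< n g) (f n) (g n) ⟩
  ∑< n f + f n + (∑< n g + g n)         ∎
  where
  open ≡-Reasoning
  open import Data.Nat.Tactic.RingSolver using (solve-∀)
  ring : ∀ a b c d → a + b + (c + d) ≡ a + c + (b + d)
  ring = solve-∀

∑-split : ∀ m n (f : ℕ → ℕ) → ∑< (m + n) f ≡ ∑< m f + ∑[ i < n ] f (m + i)
∑-split m zero    f = trans (cong (λ k → ∑< k f) (ℕP.+-identityʳ m)) (sym (ℕP.+-identityʳ (∑< m f)))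
∑-split m (suc n) f = begin
  ∑< (m + suc n) f                                  ≡⟨ cong (λ k → ∑< k f) (+-suc m n) ⟩
  ∑< (m + n) f + f (m + n)                          ≡⟨ cong (_+ f (m + n)) (∑-split m n f) ⟩
  ∑< m f + ∑[ i < n ] f (m + i) + f (m + n)         ≡⟨ +-assoc (∑< m f) _ (f (m + n)) ⟩
  ∑< m f + (∑[ i < n ] f (m + i) + f (m + n))       ∎
  where open ≡-Reasoning

∑-blocks : ∀ n m (f : ℕ → ℕ) → ∑< (n * m) f ≡ ∑[ r < m ] ∑[ y < n ] f (r + m * y)
∑-blocks zero    m f = sym (∑-zero m (λ _ → refl))
∑-blocks (suc n) m f = begin
  ∑< (m + n * m) f                                              ≡⟨ cong (λ k → ∑< k f) (+-comm m (n * m)) ⟩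
  ∑< (n * m + m) f                                              ≡⟨ ∑-split (n * m) m f ⟩
  ∑< (n * m) f + ∑[ r < m ] f (n * m + r)                       ≡⟨ cong₂ _+_ (∑-blocks n m f) (∑-cong m top-block) ⟩
  ∑[ r < m ] ∑[ y < n ] f (r + m * y) + ∑[ r < m ] f (r + m * n) ≡⟨ ∑-distrib-+ m _ _ ⟨
  ∑[ r < m ] ∑[ y < suc n ] f (r + m * y)                       ∎
  where
  open ≡-Reasoning
  top-block : ∀ r → f (n * m + r) ≡ f (r + m * n)
  top-block r = cong f (trans (+-comm (n * m) r) (cong (λ t → r + t) (*-comm n m)))

χ : {A : Set} → Dec A → ℕ
χ (yes _) = 1
χ (no _)  = 0

χ-≤1 : {A : Set} (a? : Dec A) → χ a? ≤ 1
χ-≤1 (yes _) = ≤-refl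
χ-≤1 (no _)  = z≤n

χ-¬ : {A : Set} → ¬ A → (a? : Dec A) → χ a? ≡ 0
χ-¬ ¬a (yes a) = ⊥-elim (¬a a)
χ-¬ ¬a (no _)  = refl

χ-cong : {A B : Set} → (A → B) → (B → A) → (a? : Dec A) (b? : Dec B) → χ a? ≡ χ b?
χ-cong A→B B→A (yes a) (yes b) = refl
χ-cong A→B B→A (yes a) (no ¬b) = ⊥-elim (¬b (A→B a))
χ-cong A→B B→A (no ¬a) (yes b) = ⊥-elim (¬a (B→A b))
χ-cong A→B B→A (no ¬a) (no ¬b) = refl

length-filter-tabulate : ∀ {A : Set} {P : A → Set} (P? : U.Decidable P) n (f : Fin n → A) (g : ℕ → ℕ) →
  (∀ i → χ (P? (f i)) ≡ g (toℕ i)) → length (filter P? (tabulate f)) ≡ ∑< n g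
length-filter-tabulate P? zero    f g χ≗g = refl
length-filter-tabulate P? (suc n) f g χ≗g
  with P? (f Fin.zero) | χ≗g Fin.zero | length-filter-tabulate P? n (f ∘ Fin.suc) (g ∘ suc) (χ≗g ∘ Fin.suc)
... | yes _ | g0≡1 | rest = trans (cong suc rest) (trans (cong (_+ ∑< n (g ∘ suc)) g0≡1) (sym (∑-split 1 n g)))
... | no _  | g0≡0 | rest = trans rest (trans (cong (_+ ∑< n (g ∘ suc)) g0≡0) (sym (∑-split 1 n g)))

rootCount-∑ : ∀ N h → rootCount N h ≡ ∑[ a < N ] χ (N ∣? ∣ eval h (+ a) ∣)
rootCount-∑ N h = length-filter-tabulate _ N id _ (λ _ → refl)

≤-ceilDiv* : ∀ m d .{{_ : NonZero d}} → m ≤ ceilDiv m d * d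
≤-ceilDiv* m (suc e) = ℕP.+-cancelʳ-≤ e m _ (begin
  m + e                       ≡⟨ m≡m%n+[m/n]*n (m + e) (suc e) ⟩
  (m + e) % suc e + q * suc e ≤⟨ +-monoˡ-≤ _ (ℕP.≤-pred (m%n<n (m + e) (suc e))) ⟩
  e + q * suc e               ≡⟨ +-comm e _ ⟩
  q * suc e + e               ∎)
  where
  open ℕP.≤-Reasoning
  q = (m + e) / suc e

ceilDiv-least : ∀ m d t .{{_ : NonZero d}} → m ≤ t * d → ceilDiv m d ≤ t
ceilDiv-least m (suc e) t m≤td = ℕP.≤-pred (m<n*o⇒m/o<n (begin-strict
  m + e                ≤⟨ +-monoˡ-≤ e m≤td ⟩
  t * suc e + e        <⟨ ℕP.n<1+n _ ⟩
  suc (t * suc e + e)  ≡⟨ cong suc (+-comm (t * suc e) e) ⟩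
  suc t * suc e        ∎))
  where open ℕP.≤-Reasoning

ceilDiv≤1 : ∀ m d .{{_ : NonZero d}} → m ≤ d → ceilDiv m d ≤ 1
ceilDiv≤1 m d m≤d = ceilDiv-least m d 1 (≤-trans m≤d (≤-reflexive (sym (ℕP.*-identityˡ d))))

ceilDiv-∸ : ∀ m c d e .{{_ : NonZero d}} .{{_ : NonZero e}} → e ≤ d → c ≤ d →
  ceilDiv m d ≤ suc (ceilDiv (m ∸ c) e)
ceilDiv-∸ m c d e e≤d c≤d = ceilDiv-least m d (suc A) (begin
  m                ≤⟨ ℕP.m≤n+m∸n m c ⟩
  c + (m ∸ c)      ≤⟨ +-mono-≤ c≤d (≤-ceilDiv* (m ∸ c) e) ⟩
  d + A * e        ≤⟨ +-monoʳ-≤ d (ℕP.*-monoʳ-≤ A e≤d) ⟩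
  d + A * d        ∎)
  where
  open ℕP.≤-Reasoning
  A = ceilDiv (m ∸ c) e

m^i*x≡m^j*y⇒m∣x : ∀ m .{{_ : NonZero m}} {i j x y} → i < j → m ^ i * x ≡ m ^ j * y → m ∣ x
m^i*x≡m^j*y⇒m∣x m {i} {j} {x} {y} i<j eq =
  divides (m ^ t * y) (ℕP.*-cancelˡ-≡ x _ (m ^ i) {{ℕP.m^n≢0 m i}} (begin
  m ^ i * x                ≡⟨ eq ⟩
  m ^ j * y                ≡⟨ cong (λ k → m ^ k * y) (ℕP.m+[n∸m]≡n i<j) ⟨
  m ^ (suc i + t) * y      ≡⟨ cong (_* y) (ℕP.^-distribˡ-+-* m (suc i) t) ⟩
  m * m ^ i * m ^ t * y    ≡⟨ ring m (m ^ i) (m ^ t) y ⟩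
  m ^ i * (m ^ t * y * m)  ∎))
  where
  open ≡-Reasoning
  open import Data.Nat.Tactic.RingSolver using (solve-∀)
  t = j ∸ suc i
  ring : ∀ m a b y → m * a * b * y ≡ a * (b * y * m)
  ring = solve-∀

∣-coeffs⇒∣-eval : ∀ {k} Q → (∀ i → k ∣ᵢ coeff Q i) → ∀ a → k ∣ᵢ eval Q a
∣-coeffs⇒∣-eval {k} []       _       a = ∣ᵤ⇒∣ (∣ k ∣ ℕD.∣0)
∣-coeffs⇒∣-eval     (c ∷ cs) k∣coeff a =
  ∣m∣n⇒∣m+n (k∣coeff 0) (∣n⇒∣m*n a (∣-coeffs⇒∣-eval cs (k∣coeff ∘ suc) a))

divide-or-witness : ∀ m (Q : Poly) → (Σ Poly λ Q′ → Q ≡ m ·ₚ Q′) ⊎ (Σ ℕ λ k → ¬ m ∣ᵢ coeff Q k)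
divide-or-witness m []       = inj₁ ([] , refl)
divide-or-witness m (c ∷ cs) with m ∣ᵢ? c | divide-or-witness m cs
... | no m∤c           | _                   = inj₂ (0 , m∤c)
... | yes _            | inj₂ (k , m∤coeff)  = inj₂ (suc k , m∤coeff)
... | yes (dividesᵢ q c≡qm) | inj₁ (Q′ , cs≡mQ′) =
  inj₁ (q ∷ Q′ , cong₂ _∷_ (trans c≡qm (ℤP.*-comm q m)) cs≡mQ′)

·ₚ-pow-suc : ∀ m c Q → + m ·ₚ + (m ^ c) ·ₚ Q ≡ + (m ^ suc c) ·ₚ Q
·ₚ-pow-suc m c Q = trans (·ₚ-assoc (+ m) (+ (m ^ c)) Q) (cong (_·ₚ Q) (sym (ℤP.pos-* m (m ^ c))))

content-decomposition : ∀ m b (R : Poly) → (∀ Q → R ≢ + (m ^ b) ·ₚ Q) →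
  Σ ℕ λ c → Σ Poly λ Q → R ≡ + (m ^ c) ·ₚ Q × Σ ℕ λ k → ¬ + m ∣ᵢ coeff Q k
content-decomposition m zero    R m⁰∤R = ⊥-elim (m⁰∤R R (sym (·ₚ-identityˡ R)))
content-decomposition m (suc b) R mᵇ⁺¹∤R with divide-or-witness (+ m) R
... | inj₂ witness      = 0 , R , sym (·ₚ-identityˡ R) , witness
... | inj₁ (R′ , R≡mR′) =
  let c , Q , R′≡mᶜQ , witness = content-decomposition m b R′ (λ Q → mᵇ⁺¹∤R Q ∘ R≡mᶜ⁺¹Q b Q)
  in suc c , Q , R≡mᶜ⁺¹Q c Q R′≡mᶜQ , witness
  where
  R≡mᶜ⁺¹Q : ∀ c Q → R′ ≡ + (m ^ c) ·ₚ Q → R ≡ + (m ^ suc c) ·ₚ Q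
  R≡mᶜ⁺¹Q c Q R′≡mᶜQ = trans R≡mR′ (trans (cong (+ m ·ₚ_) R′≡mᶜQ) (·ₚ-pow-suc m c Q))

module _ (p : ℕ) (p-prime : Prime p) where

  private instance
    p≢0 : NonZero p
    p≢0 = prime⇒nonZero p-prime

  DegModPˢ : Poly → ℕ → Set
  DegModPˢ h d = ¬ + p ∣ᵢ coeff h d × (∀ i → d < i → + p ∣ᵢ coeff h i)

  DegModP⇒DegModPˢ : ∀ h d → DegModP p h d → DegModPˢ h d
  DegModP⇒DegModPˢ h d (p∤lead , p∣high) = p∤lead ∘ ∣⇒∣ᵤ , λ i d<i → ∣ᵤ⇒∣ (p∣high i d<i)

  DegModPˢ-tail : ∀ {c cs d} → DegModPˢ (c ∷ cs) (suc d) → DegModPˢ cs d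
  DegModPˢ-tail (p∤lead , p∣high) = p∤lead , λ i d<i → p∣high (suc i) (s≤s d<i)

  DegModPˢ-∷ : ∀ {c cs d} → DegModPˢ cs d → DegModPˢ (c ∷ cs) (suc d)
  DegModPˢ-∷ (p∤lead , p∣high) = p∤lead , λ { (suc i) (s≤s d<i) → p∣high i d<i }

  degree-zero⇒¬root : ∀ h → DegModPˢ h 0 → ∀ a → ¬ + p ∣ᵢ eval h a
  degree-zero⇒¬root []       (p∤lead , _)      a _      = p∤lead (∣ᵤ⇒∣ (p ℕD.∣0))
  degree-zero⇒¬root (c ∷ cs) (p∤lead , p∣high) a p∣h[a] =
    p∤lead (∣m+n∣n⇒∣m p∣h[a] (∣n⇒∣m*n a (∣-coeffs⇒∣-eval cs (λ i → p∣high (suc i) (s≤s z≤n)) a)))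

  ∣-syntheticDiv : ∀ h r → (∀ i → 0 < i → + p ∣ᵢ coeff h i) → ∀ i → + p ∣ᵢ coeff (syntheticDiv h r) i
  ∣-syntheticDiv []       r _      i       = ∣ᵤ⇒∣ (p ℕD.∣0)
  ∣-syntheticDiv (c ∷ cs) r p∣high zero    = ∣-coeffs⇒∣-eval cs (λ i → p∣high (suc i) (s≤s z≤n)) r
  ∣-syntheticDiv (c ∷ cs) r p∣high (suc i) = ∣-syntheticDiv cs r (λ j _ → p∣high (suc j) (s≤s z≤n)) i

  syntheticDiv-degree : ∀ h r d → DegModPˢ h (suc d) → DegModPˢ (syntheticDiv h r) d
  syntheticDiv-degree []       r d       (p∤lead , _) = ⊥-elim (p∤lead (∣ᵤ⇒∣ (p ℕD.∣0)))
  syntheticDiv-degree (c ∷ cs) r zero    deg          =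
    degree-zero⇒¬root cs (DegModPˢ-tail {c} deg) r ,
    λ { (suc i) _ → ∣-syntheticDiv cs r (proj₂ (DegModPˢ-tail {c} deg)) i }
  syntheticDiv-degree (c ∷ cs) r (suc d) deg          =
    DegModPˢ-∷ (syntheticDiv-degree cs r d (DegModPˢ-tail {c} deg))

  p∣xy⇒p∤x⇒p∣y : ∀ {x y} → + p ∣ᵢ x ℤ.* y → ¬ + p ∣ᵢ x → + p ∣ᵢ y
  p∣xy⇒p∤x⇒p∣y {x} {y} p∣xy p∤x
    with euclidsLemma ∣ x ∣ ∣ y ∣ p-prime (subst (p ∣_) (ℤP.abs-* x y) (∣⇒∣ᵤ p∣xy))
  ... | inj₁ p∣x = ⊥-elim (p∤x (∣ᵤ⇒∣ p∣x))
  ... | inj₂ p∣y = ∣ᵤ⇒∣ p∣y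

  p∤-gap : ∀ {a b} → a < b → b < p → ¬ p ∣ b ∸ a
  p∤-gap {a} {b} a<b b<p p∣b-a =
    ℕP.<⇒≱ b<p (≤-trans (ℕD.∣⇒≤ {{ℕ.>-nonZero (ℕP.m<n⇒0<n∸m a<b)}} p∣b-a) (ℕP.m∸n≤m b a))

  p∤-difference : ∀ {s r} → s < p → r < p → s ≢ r → ¬ + p ∣ᵢ (+ s ℤ.- + r)
  p∤-difference {s} {r} s<p r<p s≢r p∣s-r
    with ℕP.<-cmp s r | subst (p ∣_) (cong ∣_∣ (ℤP.[+m]-[+n]≡m⊖n s r)) (∣⇒∣ᵤ p∣s-r)
  ... | tri≈ _ s≡r _ | _        = s≢r s≡r
  ... | tri< s<r _ _ | p∣∣s⊖r∣ = p∤-gap s<r r<p (subst (p ∣_) (ℤP.∣⊖∣-< s<r) p∣∣s⊖r∣)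
  ... | tri> _ _ r<s | p∣∣s⊖r∣ = p∤-gap r<s s<p (subst (p ∣_) (trans (ℤP.∣m⊖n∣≡∣n⊖m∣ s r) (ℤP.∣⊖∣-< r<s)) p∣∣s⊖r∣)

  RootOfOrder : Poly → ℕ → ℕ → Set
  RootOfOrder h r j = ∀ k → k < j → + p ∣ᵢ taylorCoeff h (+ r) k

  RootOfOrder-suc⇒root : ∀ h r {j} → RootOfOrder h r (suc j) → + p ∣ᵢ eval h (+ r)
  RootOfOrder-suc⇒root h r root = subst (+ p ∣ᵢ_) (taylorCoeff-zero h (+ r)) (root 0 (s≤s z≤n))

  syntheticDiv-order-same : ∀ h r {j} → RootOfOrder h r (suc j) → RootOfOrder (syntheticDiv h (+ r)) r j
  syntheticDiv-order-same h r root k k<j = subst (+ p ∣ᵢ_) shift-down (root (suc k) (s≤s k<j))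
    where
    q = syntheticDiv h (+ r)
    shift-down : taylorCoeff h (+ r) (suc k) ≡ taylorCoeff q (+ r) k
    shift-down = trans (taylorCoeff-syntheticDiv-suc h (+ r) (+ r) k) (ring (+ r) _ _)
      where
      open import Data.Integer.Tactic.RingSolver using (solve-∀)
      ring : ∀ r A B → (r ℤ.- r) ℤ.* A ℤ.+ B ≡ B
      ring = solve-∀

  -- Since p ∤ s - r, the identities taylorCoeff-syntheticDiv-* pass divisibility from h to the quotient.
  syntheticDiv-order-other : ∀ h r s {i} → s < p → r < p → s ≢ r → + p ∣ᵢ eval h (+ r) →
    RootOfOrder h s i → RootOfOrder (syntheticDiv h (+ r)) s i
  syntheticDiv-order-other h r s s<p r<p s≢r p∣h[r] root = go
    where
    go : ∀ k → k < _ → + p ∣ᵢ taylorCoeff (syntheticDiv h (+ r)) (+ s) k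
    go zero    k<i = p∣xy⇒p∤x⇒p∣y
      (∣m+n∣n⇒∣m (subst (+ p ∣ᵢ_) (taylorCoeff-syntheticDiv-zero h (+ r) (+ s)) (root 0 k<i)) p∣h[r])
      (p∤-difference s<p r<p s≢r)
    go (suc k) k<i = p∣xy⇒p∤x⇒p∣y
      (∣m+n∣n⇒∣m (subst (+ p ∣ᵢ_) (taylorCoeff-syntheticDiv-suc h (+ r) (+ s) k) (root (suc k) k<i))
                 (go k (ℕP.<-trans (ℕP.n<1+n k) k<i)))
      (p∤-difference s<p r<p s≢r)

  divideOutRoot : Poly → ℕ → ℕ → Poly
  divideOutRoot h r zero    = h
  divideOutRoot h r (suc j) = divideOutRoot (syntheticDiv h (+ r)) r j

  divideOutRoot-degree : ∀ h r {d} j → DegModPˢ h d → RootOfOrder h r j →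
    j ≤ d × DegModPˢ (divideOutRoot h r j) (d ∸ j)
  divideOutRoot-degree h r         zero    deg _    = z≤n , deg
  divideOutRoot-degree h r {zero}  (suc j) deg root =
    ⊥-elim (degree-zero⇒¬root h deg (+ r) (RootOfOrder-suc⇒root h r root))
  divideOutRoot-degree h r {suc d} (suc j) deg root =
    let j≤d , deg′ = divideOutRoot-degree (syntheticDiv h (+ r)) r j (syntheticDiv-degree h (+ r) d deg)
                                          (syntheticDiv-order-same h r root)
    in s≤s j≤d , deg′

  order≤degree : ∀ h r {d j} → DegModPˢ h d → RootOfOrder h r j → j ≤ d
  order≤degree h r deg root = proj₁ (divideOutRoot-degree h r _ deg root)

  divideOutRoot-order-other : ∀ h r s {i} j → s < p → r < p → s ≢ r →
    RootOfOrder h r j → RootOfOrder h s i → RootOfOrder (divideOutRoot h r j) s i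
  divideOutRoot-order-other h r s zero    s<p r<p s≢r _     rootₛ = rootₛ
  divideOutRoot-order-other h r s (suc j) s<p r<p s≢r rootᵣ rootₛ =
    divideOutRoot-order-other (syntheticDiv h (+ r)) r s j s<p r<p s≢r (syntheticDiv-order-same h r rootᵣ)
      (syntheticDiv-order-other h r s s<p r<p s≢r (RootOfOrder-suc⇒root h r rootᵣ) rootₛ)

  orders-sum-≤-degree : ∀ n → n ≤ p → ∀ h {d} (w : ℕ → ℕ) → DegModPˢ h d →
    (∀ r → r < n → RootOfOrder h r (w r)) → ∑< n w ≤ d
  orders-sum-≤-degree zero    _   h     w deg roots = z≤n
  orders-sum-≤-degree (suc n) n<p h {d} w deg roots = begin
    ∑< n w + w n   ≤⟨ +-monoˡ-≤ (w n) (orders-sum-≤-degree n (ℕP.<⇒≤ n<p) h′ {d ∸ w n} w deg′ roots′) ⟩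
    d ∸ w n + w n  ≡⟨ ℕP.m∸n+n≡m wn≤d ⟩
    d              ∎
    where
    open ℕP.≤-Reasoning
    h′ = divideOutRoot h n (w n)
    divided = divideOutRoot-degree h n (w n) deg (roots n ℕP.≤-refl)
    wn≤d = proj₁ divided
    deg′ = proj₂ divided
    roots′ : ∀ r → r < n → RootOfOrder h′ r (w r)
    roots′ r r<n = divideOutRoot-order-other h n r (w n) (ℕP.<-trans r<n n<p) n<p (ℕP.<⇒≢ r<n)
      (roots n ℕP.≤-refl) (roots r (ℕP.m<n⇒m<1+n r<n))

  degree-exists : ∀ Q j → (∀ k → j < k → + p ∣ᵢ coeff Q k) → ∀ k₀ → ¬ + p ∣ᵢ coeff Q k₀ →
    Σ ℕ λ e → e ≤ j × DegModPˢ Q e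
  degree-exists Q j p∣high k₀ p∤coeff with + p ∣ᵢ? coeff Q j
  ... | no p∤coeffⱼ = j , ℕP.≤-refl , p∤coeffⱼ , p∣high
  degree-exists Q zero p∣high zero      p∤coeff | yes p∣coeff₀ = ⊥-elim (p∤coeff p∣coeff₀)
  degree-exists Q zero p∣high (suc k₀) p∤coeff | yes _        = ⊥-elim (p∤coeff (p∣high (suc k₀) (s≤s z≤n)))
  degree-exists Q (suc j) p∣high k₀    p∤coeff | yes p∣coeffⱼ₊₁ =
    let e , e≤j , deg = degree-exists Q j p∣high′ k₀ p∤coeff in e , ℕP.m≤n⇒m≤1+n e≤j , deg
    where
    p∣high′ : ∀ k → j < k → + p ∣ᵢ coeff Q k
    p∣high′ k j<k with ℕP.m≤n⇒m<n∨m≡n j<k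
    ... | inj₁ j+1<k = p∣high k j+1<k
    ... | inj₂ refl  = p∣coeffⱼ₊₁

  shiftScale : Poly → ℕ → Poly
  shiftScale f r = dilate (+ p) (taylor f (+ r))

  eval-shiftScale : ∀ f r y → eval (shiftScale f r) (+ y) ≡ eval f (+ (r + p * y))
  eval-shiftScale f r y = begin
    eval (dilate (+ p) (taylor f (+ r))) (+ y)  ≡⟨ eval-dilate (+ p) (taylor f (+ r)) (+ y) ⟩
    eval (taylor f (+ r)) (+ p ℤ.* + y)         ≡⟨ eval-taylor f (+ r) (+ p ℤ.* + y) ⟩
    eval f (+ r ℤ.+ + p ℤ.* + y)                ≡⟨ cong (λ t → eval f (+ r ℤ.+ t)) (ℤP.pos-* p y) ⟨
    eval f (+ r ℤ.+ + (p * y))                  ≡⟨ cong (eval f) (ℤP.pos-+ r (p * y)) ⟨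
    eval f (+ (r + p * y))                      ∎
    where open ≡-Reasoning

  module _ (f : Poly) (r : ℕ) {c Q} (rescaled : shiftScale f r ≡ + (p ^ c) ·ₚ Q) where

    private
      coeff-rescaled : ∀ k → p ^ k * ∣ taylorCoeff f (+ r) k ∣ ≡ p ^ c * ∣ coeff Q k ∣
      coeff-rescaled k = begin
        p ^ k * ∣ taylorCoeff f (+ r) k ∣       ≡⟨ ℤP.abs-* (+ (p ^ k)) (taylorCoeff f (+ r) k) ⟨
        ∣ + (p ^ k) ℤ.* taylorCoeff f (+ r) k ∣ ≡⟨ cong ∣_∣ (coeff-dilate p (taylor f (+ r)) k) ⟨
        ∣ coeff (shiftScale f r) k ∣            ≡⟨ cong (λ L → ∣ coeff L k ∣) rescaled ⟩
        ∣ coeff (+ (p ^ c) ·ₚ Q) k ∣            ≡⟨ cong ∣_∣ (coeff-·ₚ (+ (p ^ c)) Q k) ⟩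
        ∣ + (p ^ c) ℤ.* coeff Q k ∣             ≡⟨ ℤP.abs-* (+ (p ^ c)) (coeff Q k) ⟩
        p ^ c * ∣ coeff Q k ∣                   ∎
        where open ≡-Reasoning

    rescaled⇒RootOfOrder : RootOfOrder f r c
    rescaled⇒RootOfOrder k k<c = ∣ᵤ⇒∣ (m^i*x≡m^j*y⇒m∣x p k<c (coeff-rescaled k))

    rescaled⇒p∣high : ∀ k → c < k → + p ∣ᵢ coeff Q k
    rescaled⇒p∣high k c<k = ∣ᵤ⇒∣ (m^i*x≡m^j*y⇒m∣x p c<k (sym (coeff-rescaled k)))

    rescaled⇒∣-equiv : ∀ {n} → c ≤ n → ∀ y →
      (p ^ n ∣ ∣ eval f (+ (r + p * y)) ∣ → p ^ (n ∸ c) ∣ ∣ eval Q (+ y) ∣) ×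
      (p ^ (n ∸ c) ∣ ∣ eval Q (+ y) ∣ → p ^ n ∣ ∣ eval f (+ (r + p * y)) ∣)
    rescaled⇒∣-equiv {n} c≤n y =
      (λ pⁿ∣f → ℕD.*-cancelˡ-∣ (p ^ c) {{ℕP.m^n≢0 p c}} (subst₂ _∣_ pⁿ≡ ∣f∣≡ pⁿ∣f)) ,
      (λ pⁿ⁻ᶜ∣Q → subst₂ _∣_ (sym pⁿ≡) (sym ∣f∣≡) (ℕD.*-monoʳ-∣ (p ^ c) pⁿ⁻ᶜ∣Q))
      where
      pⁿ≡ : p ^ n ≡ p ^ c * p ^ (n ∸ c)
      pⁿ≡ = trans (cong (p ^_) (sym (ℕP.m+[n∸m]≡n c≤n))) (ℕP.^-distribˡ-+-* p c (n ∸ c))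
      ∣f∣≡ : ∣ eval f (+ (r + p * y)) ∣ ≡ p ^ c * ∣ eval Q (+ y) ∣
      ∣f∣≡ = begin
        ∣ eval f (+ (r + p * y)) ∣           ≡⟨ cong ∣_∣ (eval-shiftScale f r y) ⟨
        ∣ eval (shiftScale f r) (+ y) ∣      ≡⟨ cong (λ L → ∣ eval L (+ y) ∣) rescaled ⟩
        ∣ eval (+ (p ^ c) ·ₚ Q) (+ y) ∣      ≡⟨ cong ∣_∣ (eval-·ₚ (+ (p ^ c)) Q (+ y)) ⟩
        ∣ + (p ^ c) ℤ.* eval Q (+ y) ∣       ≡⟨ ℤP.abs-* (+ (p ^ c)) (eval Q (+ y)) ⟩
        p ^ c * ∣ eval Q (+ y) ∣             ∎
        where open ≡-Reasoning

  record Descent (f : Poly) (r : ℕ) : Set where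
    field
      valuation               : ℕ
      reduced                 : Poly
      reducedDegree           : ℕ
      rescaled                : shiftScale f r ≡ + (p ^ valuation) ·ₚ reduced
      reducedDegree≤valuation : reducedDegree ≤ valuation
      isReducedDegree         : DegModPˢ reduced reducedDegree

  -- Otherwise r would be a root of f of order d + 1.
  pᵈ⁺¹∤shiftScale : ∀ f d → DegModPˢ f d → ∀ r Q → shiftScale f r ≢ + (p ^ suc d) ·ₚ Q
  pᵈ⁺¹∤shiftScale f d deg r Q rescaled = ℕP.1+n≰n (order≤degree f r deg (rescaled⇒RootOfOrder f r rescaled))

  descent : ∀ f d → DegModPˢ f d → ∀ r → Descent f r
  descent f d deg r with content-decomposition p (suc d) (shiftScale f r) (pᵈ⁺¹∤shiftScale f d deg r)
  ... | c , Q , rescaled , k₀ , p∤Qk₀ with degree-exists Q c (rescaled⇒p∣high f r rescaled) k₀ p∤Qk₀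
  ... | e , e≤c , degQ = record
    { valuation = c ; reduced = Q ; reducedDegree = e
    ; rescaled = rescaled ; reducedDegree≤valuation = e≤c ; isReducedDegree = degQ }

  rootsMod : Poly → ℕ → ℕ → ℕ
  rootsMod f k n = ∑[ a < p ^ k ] χ (p ^ n ∣? ∣ eval f (+ a) ∣)

  rootsMod-degree-zero : ∀ f k n → DegModPˢ f 0 → 1 ≤ n → rootsMod f k n ≡ 0
  rootsMod-degree-zero f k (suc n) deg _ = ∑-zero (p ^ k) λ a → χ-¬
    (λ pⁿ∣f[a] → degree-zero⇒¬root f deg (+ a) (∣ᵤ⇒∣ (ℕD.∣-trans (ℕD.m∣m*n (p ^ n)) pⁿ∣f[a]))) _

  rootsInFibre : Poly → ℕ → ℕ → ℕ → ℕ
  rootsInFibre f r k n = ∑[ y < p ^ k ] χ (p ^ n ∣? ∣ eval f (+ (r + p * y)) ∣)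

  rootsMod-suc : ∀ f k n → rootsMod f (suc k) n ≡ ∑[ r < p ] rootsInFibre f r k n
  rootsMod-suc f k n = trans (cong (λ N → ∑< N G) (*-comm p (p ^ k))) (∑-blocks (p ^ k) p G)
    where
    G : ℕ → ℕ
    G a = χ (p ^ n ∣? ∣ eval f (+ a) ∣)

  rootsInFibre-rescaled : ∀ f r k n {c Q} → shiftScale f r ≡ + (p ^ c) ·ₚ Q → c ≤ n →
    rootsInFibre f r k n ≡ rootsMod Q k (n ∸ c)
  rootsInFibre-rescaled f r k n rescaled c≤n = ∑-cong (p ^ k) λ y →
    let f⇒Q , Q⇒f = rescaled⇒∣-equiv f r rescaled c≤n y in χ-cong f⇒Q Q⇒f _ _

  CountBound : ℕ → Set
  CountBound k = ∀ f d .{{_ : NonZero d}} → DegModPˢ f d → ∀ n → 1 ≤ n → n ≤ k →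
    rootsMod f k n ≤ d * p ^ (k ∸ ceilDiv n d)

  -- When pⁿ divides pᶜ every y counts; the bound p^k is absorbed since ⌈n/d⌉ ≤ 1.
  rootsInFibre-shallow : ∀ f r k n c d .{{_ : NonZero d}} → 1 ≤ n → n ≤ c → c ≤ d →
    rootsInFibre f r k n ≤ c * p ^ (suc k ∸ ceilDiv n d)
  rootsInFibre-shallow f r k n c@(suc _) d 1≤n n≤c c≤d = begin
    rootsInFibre f r k n            ≤⟨ ∑-≤-length (p ^ k) (λ _ → χ-≤1 _) ⟩
    p ^ k                           ≤⟨ ℕP.^-monoʳ-≤ p (ℕP.∸-monoʳ-≤ (suc k) (ceilDiv≤1 n d (≤-trans n≤c c≤d))) ⟩
    p ^ (suc k ∸ ceilDiv n d)       ≤⟨ ℕP.m≤n*m _ c ⟩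
    c * p ^ (suc k ∸ ceilDiv n d)   ∎
    where open ℕP.≤-Reasoning
  rootsInFibre-shallow f r k n zero d (s≤s _) () _

  rootsInFibre-deep : ∀ {k} → CountBound k → ∀ f r {c Q} e → shiftScale f r ≡ + (p ^ c) ·ₚ Q →
    e ≤ c → DegModPˢ Q e → ∀ n d .{{_ : NonZero d}} → c < n → n ≤ suc k → c ≤ d →
    rootsInFibre f r k n ≤ c * p ^ (suc k ∸ ceilDiv n d)
  rootsInFibre-deep {k} bound f r {c} {Q} zero rescaled _ degQ n d c<n _ _ = begin
    rootsInFibre f r k n  ≡⟨ rootsInFibre-rescaled f r k n rescaled (ℕP.<⇒≤ c<n) ⟩
    rootsMod Q k (n ∸ c)  ≡⟨ rootsMod-degree-zero Q k (n ∸ c) degQ (ℕP.m<n⇒0<n∸m c<n) ⟩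
    0                     ≤⟨ z≤n ⟩
    c * p ^ (suc k ∸ ceilDiv n d) ∎
    where open ℕP.≤-Reasoning
  rootsInFibre-deep {k} bound f r {c} {Q} e@(suc _) rescaled e≤c degQ n d c<n n≤1+k c≤d = begin
    rootsInFibre f r k n                      ≡⟨ rootsInFibre-rescaled f r k n rescaled (ℕP.<⇒≤ c<n) ⟩
    rootsMod Q k (n ∸ c)                      ≤⟨ bound Q e degQ (n ∸ c) (ℕP.m<n⇒0<n∸m c<n) n∸c≤k ⟩
    e * p ^ (k ∸ ceilDiv (n ∸ c) e)           ≤⟨ ℕP.*-mono-≤ e≤c (ℕP.^-monoʳ-≤ p (ℕP.∸-monoʳ-≤ (suc k) ⌈n/d⌉≤)) ⟩
    c * p ^ (suc k ∸ ceilDiv n d)             ∎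
    where
    open ℕP.≤-Reasoning
    n∸c≤k : n ∸ c ≤ k
    n∸c≤k = ≤-trans (ℕP.∸-monoʳ-≤ n (≤-trans (s≤s z≤n) e≤c)) (ℕP.∸-monoˡ-≤ 1 n≤1+k)
    ⌈n/d⌉≤ : ceilDiv n d ≤ suc (ceilDiv (n ∸ c) e)
    ⌈n/d⌉≤ = ceilDiv-∸ n c d e (≤-trans e≤c c≤d) c≤d

  rootsInFibre-bound : ∀ {k} → CountBound k → ∀ {f r} (D : Descent f r) → ∀ n d .{{_ : NonZero d}} →
    1 ≤ n → n ≤ suc k → Descent.valuation D ≤ d →
    rootsInFibre f r k n ≤ Descent.valuation D * p ^ (suc k ∸ ceilDiv n d)
  rootsInFibre-bound bound {f} {r} D n d 1≤n n≤1+k c≤d with ℕP.≤-<-connex n (Descent.valuation D)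
  ... | inj₁ n≤c = rootsInFibre-shallow f r _ n _ d 1≤n n≤c c≤d
  ... | inj₂ c<n = rootsInFibre-deep bound f r _ rescaled reducedDegree≤valuation isReducedDegree n d c<n n≤1+k c≤d
    where open Descent D

  -- Split a = r + p y; the fibre over r contributes at most c_r p^(k+1-⌈n/d⌉), and Σ c_r ≤ d.
  countBound-suc : ∀ {k} → CountBound k → CountBound (suc k)
  countBound-suc {k} bound f d deg n 1≤n n≤1+k = begin
    rootsMod f (suc k) n                  ≡⟨ rootsMod-suc f k n ⟩
    ∑[ r < p ] rootsInFibre f r k n       ≤⟨ ∑-mono-≤ p (λ r → rootsInFibre-bound bound (D r) n d 1≤n n≤1+k (c≤d r)) ⟩
    ∑[ r < p ] (c r * X)                  ≡⟨ ∑-distribʳ-* p c X ⟩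
    ∑< p c * X                            ≤⟨ ℕP.*-monoˡ-≤ X (orders-sum-≤-degree p ℕP.≤-refl f c deg (λ r _ → order r)) ⟩
    d * X                                 ∎
    where
    open ℕP.≤-Reasoning
    X = p ^ (suc k ∸ ceilDiv n d)
    D = descent f d deg
    c : ℕ → ℕ
    c r = Descent.valuation (D r)
    order : ∀ r → RootOfOrder f r (c r)
    order r = rescaled⇒RootOfOrder f r (Descent.rescaled (D r))
    c≤d : ∀ r → c r ≤ d
    c≤d r = order≤degree f r deg (order r)

  countBound : ∀ k → CountBound k
  countBound zero    f d deg n 1≤n n≤0 = ⊥-elim (ℕP.<⇒≱ 1≤n n≤0)
  countBound (suc k) = countBound-suc (countBound k)

proposition2p2 : (p : ℕ) → Prime p → (h : Poly) → (d : ℕ) → .{{_ : NonZero d}} → DegModP p h d → (m : ℕ) → 1 ≤ m → rootCount (p ^ m) h ≤ d * p ^ (m ∸ ceilDiv m d)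
proposition2p2 p p-prime h d deg m 1≤m = begin
  rootCount (p ^ m) h        ≡⟨ rootCount-∑ (p ^ m) h ⟩
  rootsMod p p-prime h m m   ≤⟨ countBound p p-prime m h d (DegModP⇒DegModPˢ p p-prime h d deg) m 1≤m ℕP.≤-refl ⟩
  d * p ^ (m ∸ ceilDiv m d)  ∎
  where open ℕP.≤-Reasoning
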